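{- Let $L$ be an extension of $\mathsf{N4}^\bot$. If $L$ has a proper model $Tw(\mathbf{A},\nabla,\Delta)$ (a twist-structure over a Heyting algebra $\mathbf{A}$, with $\nabla$ a filter containing all dense elements and $\Delta$ an ideal of $\mathbf{A}$) whose ideal $\Delta$ is closed, then $\tau_{\mathbf{B}}L$ is a modal companion of $L$.
   Context: Languages: $\mathcal{L}_\sim=\{\wedge,\vee,\to,\bot,\sim\}$ and $\mathcal{L}^\Box_\sim=\mathcal{L}_\sim\cup\{\Box,\Diamond\}$, formulas over a countable set of variables; $\neg\varphi:=\varphi\to\bot$, $\varphi\leftrightarrow\psi:=(\varphi\to\psi)\wedge(\psi\to\varphi)$, $\varphi\Leftrightarrow\psi:=(\varphi\leftrightarrow\psi)\wedge(\sim\varphi\leftrightarrow\sim\psi)$. A logic in $\mathcal{L}_\sim$ is a set of formulas closed under substitution and modus ponens; a logic in $\mathcal{L}^\Box_\sim$ is additionally closed under the rules $\varphi\to\psi/\Box\varphi\to\Box\psi$ and $\varphi\to\psi/\Diamond\varphi\to\Diamond\psi$. $\mathsf{N4}^\bot$ is the least logic in $\mathcal{L}_\sim$ containing the intuitionistic axioms ($p\to(q\to p)$; $(p\to(q\to r))\to((p\to q)\to(p\to r))$; $p\wedge q\to p$; $p\wedge q\to q$; $p\to(q\to p\wedge q)$; $p\to p\vee q$; $q\to p\vee q$; $(p\to r)\to((q\to r)\to(p\vee q\to r))$; $\bot\to p$) and $\sim(p\vee q)\leftrightarrow(\sim p\wedge\sim q)$, $\sim(p\wedge q)\leftrightarrow(\sim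 p\vee\sim q)$, $\sim(p\to q)\leftrightarrow(p\wedge\sim q)$, $\sim\sim p\leftrightarrow p$, $\sim\bot$. $\mathsf{BS4}$ is the least logic in $\mathcal{L}^\Box_\sim$ containing these axioms, $p\vee\neg p$, $\Box(p\to p)$, $(\Box p\wedge\Box q)\to\Box(p\wedge q)$, $\Box p\to p$, $\Box p\to\Box\Box p$, $\neg\Box p\leftrightarrow\Diamond\neg p$, $\neg\Diamond p\leftrightarrow\Box\neg p$, $\Box p\Leftrightarrow\sim\Diamond\sim p$, $\Diamond p\Leftrightarrow\sim\Box\sim p$. Extensions are logics (in the same language) containing the given one; $L+X$ is the least logic containing $L\cup X$. Translation $\mathrm{T}_{\mathbf{B}}$: $\mathrm{T}_{\mathbf{B}}(p)=\Box p$, $\mathrm{T}_{\mathbf{B}}(\sim p)=\Box\sim p$, $\mathrm{T}_{\mathbf{B}}(\bot)=\bot$, $\mathrm{T}_{\mathbf{B}}(\sim\bot)=\sim\bot$, $\mathrm{T}_{\mathbf{B}}(\varphi\wedge\psi)=\mathrm{T}_{\mathbf{B}}\varphi\wedge\mathrm{T}_{\mathbf{B}}\psi$, $\mathrm{T}_{\mathbf{B}}(\varphi\vee\psi)=\mathrm{T}_{\mathbf{B}}\varphi\vee\mathrm{T}_{\mathbf{B}}\psi$, $\mathrm{T}_{\mathbf{B}}(\varphi\to\psi)=\Box(\mathrm{T}_{\mathbf{B}}\varphi\to\mathrm{T}_{\mathbf{B}}\psi)$, $\mathrm{T}_{\mathbf{B}}(\sim(\varphi\wedge\psi))=\mathrm{T}_{\mathbf{B}}(\sim\varphi)\vee\mathrm{T}_{\mathbf{B}}(\sim\psi)$,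 $\mathrm{T}_{\mathbf{B}}(\sim(\varphi\vee\psi))=\mathrm{T}_{\mathbf{B}}(\sim\varphi)\wedge\mathrm{T}_{\mathbf{B}}(\sim\psi)$, $\mathrm{T}_{\mathbf{B}}(\sim(\varphi\to\psi))=\mathrm{T}_{\mathbf{B}}\varphi\wedge\mathrm{T}_{\mathbf{B}}(\sim\psi)$, $\mathrm{T}_{\mathbf{B}}(\sim\sim\varphi)=\mathrm{T}_{\mathbf{B}}\varphi$. A modal companion of an extension $L$ of $\mathsf{N4}^\bot$ is an extension $M$ of $\mathsf{BS4}$ with $\varphi\in L\iff\mathrm{T}_{\mathbf{B}}\varphi\in M$ for all $\mathcal{L}_\sim$-formulas $\varphi$; $\tau_{\mathbf{B}}L:=\mathsf{BS4}+\{\mathrm{T}_{\mathbf{B}}\varphi:\varphi\in L\}$. For a Heyting algebra $\mathbf{A}$ ($\neg a:=a\to\bot$; $a$ dense if $\neg a=\bot$), filter $\nabla$ containing all dense elements and ideal $\Delta$, $Tw(\mathbf{A},\nabla,\Delta)$ is the algebra on $\{(a,b)\in A^2:a\vee b\in\nabla,\ a\wedge b\in\Delta\}$ with $(a,b)\vee(c,d)=(a\vee c,b\wedge d)$, $(a,b)\wedge(c,d)=(a\wedge c,b\vee d)$, $(a,b)\to(c,d)=(a\to c,a\wedge d)$, $\bot=(\bot,1)$, $\sim(a,b)=(b,a)$. $\mathcal{A}\models\varphi$ iff $\pi_1(v(\varphi))=1$ for every homomorphism $v$ from the formula algebra into $\mathcal{A}$; $\mathcal{A}$ is a proper model of $L$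 if $\{\varphi:\mathcal{A}\models\varphi\}=L$. $\Delta$ is closed if $\neg\neg a\in\Delta$ for all $a\in\Delta$. -}

module Defs where

open import Level using (Level; _⊔_) renaming (zero to lzero; suc to lsuc)
open import Data.Nat using (ℕ)
open import Data.Product using (_×_; _,_; proj₁; proj₂; Σ; ∃)
open import Data.Sum using (_⊎_; inj₁; inj₂)
open import Function.Bundles using (_⇔_)
open import Relation.Binary.PropositionalEquality using (_≡_)
open import Relation.Binary.Lattice.Bundles using (HeytingAlgebra)

infixr 6 _∧'_
infixr 5 _∨'_
infixr 4 _⇒_

data Fm : Set where
  var  : ℕ → Fm
  ⊥'   : Fm
  _∧'_ : Fm → Fm → Fm
  _∨'_ : Fm → Fm → Fm
  _⇒_  : Fm → Fm → Fm
  ∼_   : Fm → Fm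

¬'_ : Fm → Fm
¬' φ = φ ⇒ ⊥'

_↔'_ : Fm → Fm → Fm
φ ↔' ψ = (φ ⇒ ψ) ∧' (ψ ⇒ φ)

_⇔'_ : Fm → Fm → Fm
φ ⇔' ψ = (φ ↔' ψ) ∧' ((∼ φ) ↔' (∼ ψ))

subst : (ℕ → Fm) → Fm → Fm
subst σ (var p)  = σ p
subst σ ⊥'       = ⊥'
subst σ (φ ∧' ψ) = subst σ φ ∧' subst σ ψ
subst σ (φ ∨' ψ) = subst σ φ ∨' subst σ ψ
subst σ (φ ⇒ ψ)  = subst σ φ ⇒ subst σ ψ
subst σ (∼ φ)    = ∼ subst σ φ

infixr 6 _∧ₘ_
infixr 5 _∨ₘ_
infixr 4 _⇒ₘ_

data MFm : Set where
  var  : ℕ → MFm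
  ⊥ₘ   : MFm
  _∧ₘ_ : MFm → MFm → MFm
  _∨ₘ_ : MFm → MFm → MFm
  _⇒ₘ_ : MFm → MFm → MFm
  ∼ₘ_  : MFm → MFm
  □_   : MFm → MFm
  ◇_   : MFm → MFm

¬ₘ_ : MFm → MFm
¬ₘ φ = φ ⇒ₘ ⊥ₘ

_↔ₘ_ : MFm → MFm → MFm
φ ↔ₘ ψ = (φ ⇒ₘ ψ) ∧ₘ (ψ ⇒ₘ φ)

_⇔ₘ_ : MFm → MFm → MFm
φ ⇔ₘ ψ = (φ ↔ₘ ψ) ∧ₘ ((∼ₘ φ) ↔ₘ (∼ₘ ψ))

substₘ : (ℕ → MFm) → MFm → MFm
substₘ σ (var p)   = σ p
substₘ σ ⊥ₘ        = ⊥ₘ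
substₘ σ (φ ∧ₘ ψ)  = substₘ σ φ ∧ₘ substₘ σ ψ
substₘ σ (φ ∨ₘ ψ)  = substₘ σ φ ∨ₘ substₘ σ ψ
substₘ σ (φ ⇒ₘ ψ)  = substₘ σ φ ⇒ₘ substₘ σ ψ
substₘ σ (∼ₘ φ)    = ∼ₘ substₘ σ φ
substₘ σ (□ φ)     = □ substₘ σ φ
substₘ σ (◇ φ)     = ◇ substₘ σ φ

_⊆_ : {A : Set} → (A → Set) → (A → Set) → Set
X ⊆ Y = ∀ φ → X φ → Y φ

record IsLogic (L : Fm → Set) : Set where
  field
    closed-subst : ∀ σ φ → L φ → L (subst σ φ)
    closed-mp    : ∀ φ ψ → L φ → L (φ ⇒ ψ) → L ψ

record IsModalLogic (M : MFm → Set) : Set where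
  field
    closed-subst : ∀ σ φ → M φ → M (substₘ σ φ)
    closed-mp    : ∀ φ ψ → M φ → M (φ ⇒ₘ ψ) → M ψ
    closed-□     : ∀ φ ψ → M (φ ⇒ₘ ψ) → M ((□ φ) ⇒ₘ (□ ψ))
    closed-◇     : ∀ φ ψ → M (φ ⇒ₘ ψ) → M ((◇ φ) ⇒ₘ (◇ ψ))

data LeastLogic (X : Fm → Set) : Fm → Set where
  ax  : ∀ {φ} → X φ → LeastLogic X φ
  sub : ∀ σ {φ} → LeastLogic X φ → LeastLogic X (subst σ φ)
  mp  : ∀ {φ ψ} → LeastLogic X φ → LeastLogic X (φ ⇒ ψ) → LeastLogic X ψ

data LeastModalLogic (X : MFm → Set) : MFm → Set where
  ax  : ∀ {φ} → X φ → LeastModalLogic X φ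
  sub : ∀ σ {φ} → LeastModalLogic X φ → LeastModalLogic X (substₘ σ φ)
  mp  : ∀ {φ ψ} → LeastModalLogic X φ → LeastModalLogic X (φ ⇒ₘ ψ)
      → LeastModalLogic X ψ
  mon□ : ∀ {φ ψ} → LeastModalLogic X (φ ⇒ₘ ψ)
       → LeastModalLogic X ((□ φ) ⇒ₘ (□ ψ))
  mon◇ : ∀ {φ ψ} → LeastModalLogic X (φ ⇒ₘ ψ)
       → LeastModalLogic X ((◇ φ) ⇒ₘ (◇ ψ))

module N4Vars where
  p q r : Fm
  p = var 0
  q = var 1
  r = var 2

open N4Vars

data N4Ax : Fm → Set where
  a1  : N4Ax (p ⇒ (q ⇒ p))
  a2  : N4Ax ((p ⇒ (q ⇒ r)) ⇒ ((p ⇒ q) ⇒ (p ⇒ r)))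
  a3  : N4Ax ((p ∧' q) ⇒ p)
  a4  : N4Ax ((p ∧' q) ⇒ q)
  a5  : N4Ax (p ⇒ (q ⇒ (p ∧' q)))
  a6  : N4Ax (p ⇒ (p ∨' q))
  a7  : N4Ax (q ⇒ (p ∨' q))
  a8  : N4Ax ((p ⇒ r) ⇒ ((q ⇒ r) ⇒ ((p ∨' q) ⇒ r)))
  a9  : N4Ax (⊥' ⇒ p)
  n1  : N4Ax ((∼ (p ∨' q)) ↔' ((∼ p) ∧' (∼ q)))
  n2  : N4Ax ((∼ (p ∧' q)) ↔' ((∼ p) ∨' (∼ q)))
  n3  : N4Ax ((∼ (p ⇒ q)) ↔' (p ∧' (∼ q)))
  n4  : N4Ax ((∼ (∼ p)) ↔' p)
  n5  : N4Ax (∼ ⊥')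

N4⊥ : Fm → Set
N4⊥ = LeastLogic N4Ax

record IsExtensionN4 (L : Fm → Set) : Set where
  field
    isLogic  : IsLogic L
    contains : N4⊥ ⊆ L

pₘ qₘ rₘ : MFm
pₘ = var 0
qₘ = var 1
rₘ = var 2

data BS4Ax : MFm → Set where
  a1  : BS4Ax (pₘ ⇒ₘ (qₘ ⇒ₘ pₘ))
  a2  : BS4Ax ((pₘ ⇒ₘ (qₘ ⇒ₘ rₘ)) ⇒ₘ ((pₘ ⇒ₘ qₘ) ⇒ₘ (pₘ ⇒ₘ rₘ)))
  a3  : BS4Ax ((pₘ ∧ₘ qₘ) ⇒ₘ pₘ)
  a4  : BS4Ax ((pₘ ∧ₘ qₘ) ⇒ₘ qₘ)
  a5  : BS4Ax (pₘ ⇒ₘ (qₘ ⇒ₘ (pₘ ∧ₘ qₘ)))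
  a6  : BS4Ax (pₘ ⇒ₘ (pₘ ∨ₘ qₘ))
  a7  : BS4Ax (qₘ ⇒ₘ (pₘ ∨ₘ qₘ))
  a8  : BS4Ax ((pₘ ⇒ₘ rₘ) ⇒ₘ ((qₘ ⇒ₘ rₘ) ⇒ₘ ((pₘ ∨ₘ qₘ) ⇒ₘ rₘ)))
  a9  : BS4Ax (⊥ₘ ⇒ₘ pₘ)
  n1  : BS4Ax ((∼ₘ (pₘ ∨ₘ qₘ)) ↔ₘ ((∼ₘ pₘ) ∧ₘ (∼ₘ qₘ)))
  n2  : BS4Ax ((∼ₘ (pₘ ∧ₘ qₘ)) ↔ₘ ((∼ₘ pₘ) ∨ₘ (∼ₘ qₘ)))
  n3  : BS4Ax ((∼ₘ (pₘ ⇒ₘ qₘ)) ↔ₘ (pₘ ∧ₘ (∼ₘ qₘ)))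
  n4  : BS4Ax ((∼ₘ (∼ₘ pₘ)) ↔ₘ pₘ)
  n5  : BS4Ax (∼ₘ ⊥ₘ)
  lem : BS4Ax (pₘ ∨ₘ (¬ₘ pₘ))
  k0  : BS4Ax (□ (pₘ ⇒ₘ pₘ))
  k1  : BS4Ax (((□ pₘ) ∧ₘ (□ qₘ)) ⇒ₘ (□ (pₘ ∧ₘ qₘ)))
  t   : BS4Ax ((□ pₘ) ⇒ₘ pₘ)
  four : BS4Ax ((□ pₘ) ⇒ₘ (□ (□ pₘ)))
  d1  : BS4Ax ((¬ₘ (□ pₘ)) ↔ₘ (◇ (¬ₘ pₘ)))
  d2  : BS4Ax ((¬ₘ (◇ pₘ)) ↔ₘ (□ (¬ₘ pₘ)))
  d3  : BS4Ax ((□ pₘ) ⇔ₘ (∼ₘ (◇ (∼ₘ pₘ))))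
  d4  : BS4Ax ((◇ pₘ) ⇔ₘ (∼ₘ (□ (∼ₘ pₘ))))

BS4 : MFm → Set
BS4 = LeastModalLogic BS4Ax

record IsExtensionBS4 (M : MFm → Set) : Set where
  field
    isModalLogic : IsModalLogic M
    contains     : BS4 ⊆ M

-- The translation T_B.  TB φ is T_B(φ); TBneg φ is T_B(∼ φ)
-- (mutual recursion, so that TB (∼ φ) = TBneg φ reproduces exactly
-- the clauses for ∼-formulas).

mutual
  TB : Fm → MFm
  TB (var n)  = □ (var n)
  TB ⊥'       = ⊥ₘ
  TB (φ ∧' ψ) = TB φ ∧ₘ TB ψ
  TB (φ ∨' ψ) = TB φ ∨ₘ TB ψ
  TB (φ ⇒ ψ)  = □ (TB φ ⇒ₘ TB ψ)
  TB (∼ φ)    = TBneg φ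

  TBneg : Fm → MFm
  TBneg (var n)  = □ (∼ₘ (var n))
  TBneg ⊥'       = ∼ₘ ⊥ₘ
  TBneg (φ ∧' ψ) = TBneg φ ∨ₘ TBneg ψ
  TBneg (φ ∨' ψ) = TBneg φ ∧ₘ TBneg ψ
  TBneg (φ ⇒ ψ)  = TB φ ∧ₘ TBneg ψ
  TBneg (∼ φ)    = TB φ

_+ₘ_ : (MFm → Set) → (MFm → Set) → MFm → Set
(M +ₘ X) = LeastModalLogic (λ φ → M φ ⊎ X φ)

TBImage : (Fm → Set) → MFm → Set
TBImage L χ = Σ Fm (λ φ → L φ × (TB φ ≡ χ))

τB : (Fm → Set) → MFm → Set
τB L = BS4 +ₘ TBImage L

record ModalCompanion (L : Fm → Set) (M : MFm → Set) : Set where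
  field
    extension : IsExtensionBS4 M
    faithful  : ∀ φ → L φ ⇔ M (TB φ)

module _ {c ℓ₁ ℓ₂ : Level} (A : HeytingAlgebra c ℓ₁ ℓ₂) where
  open HeytingAlgebra A

  ¬ₐ_ : Carrier → Carrier
  ¬ₐ a = a ⇨ ⊥

  Dense : Carrier → Set ℓ₁
  Dense a = (¬ₐ a) ≈ ⊥

  record IsFilter {ℓ : Level} (F : Carrier → Set ℓ) : Set (c ⊔ ℓ ⊔ ℓ₂) where
    field
      top    : F ⊤
      upward : ∀ {a b} → a ≤ b → F a → F b
      meet   : ∀ {a b} → F a → F b → F (a ∧ b)

  record IsIdeal {ℓ : Level} (I : Carrier → Set ℓ) : Set (c ⊔ ℓ ⊔ ℓ₂) where
    field
      bot      : I ⊥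
      downward : ∀ {a b} → a ≤ b → I b → I a
      join     : ∀ {a b} → I a → I b → I (a ∨ b)

  ContainsDense : {ℓ : Level} → (Carrier → Set ℓ) → Set (c ⊔ ℓ ⊔ ℓ₁)
  ContainsDense F = ∀ a → Dense a → F a

  ClosedIdeal : {ℓ : Level} → (Carrier → Set ℓ) → Set (c ⊔ ℓ)
  ClosedIdeal I = ∀ a → I a → I (¬ₐ (¬ₐ a))

  TwElem : {ℓ : Level} → (∇ Δ : Carrier → Set ℓ) → Set (c ⊔ ℓ)
  TwElem ∇ Δ = Σ (Carrier × Carrier)
                 (λ ab → ∇ (proj₁ ab ∨ proj₂ ab) × Δ (proj₁ ab ∧ proj₂ ab))

  -- the unique homomorphism from the formula algebra into Tw(A,∇,Δ)
  -- extending an assignment of variables; we record only its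
  -- underlying pair (the Tw operations are the ones given in the paper)
  -- operations of Tw(A,∇,Δ) on underlying pairs
  _∧ₜ_ _∨ₜ_ _⇒ₜ_ : Carrier × Carrier → Carrier × Carrier → Carrier × Carrier
  (a , b) ∧ₜ (c' , d) = a ∧ c' , b ∨ d
  (a , b) ∨ₜ (c' , d) = a ∨ c' , b ∧ d
  (a , b) ⇒ₜ (c' , d) = a ⇨ c' , a ∧ d

  ∼ₜ_ : Carrier × Carrier → Carrier × Carrier
  ∼ₜ (a , b) = b , a

  ⊥ₜ : Carrier × Carrier
  ⊥ₜ = ⊥ , ⊤

  eval : {ℓ : Level} (∇ Δ : Carrier → Set ℓ)
       → (ℕ → TwElem ∇ Δ) → Fm → Carrier × Carrier
  eval ∇ Δ v (var n)  = proj₁ (v n)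
  eval ∇ Δ v ⊥'       = ⊥ₜ
  eval ∇ Δ v (φ ∧' ψ) = eval ∇ Δ v φ ∧ₜ eval ∇ Δ v ψ
  eval ∇ Δ v (φ ∨' ψ) = eval ∇ Δ v φ ∨ₜ eval ∇ Δ v ψ
  eval ∇ Δ v (φ ⇒ ψ)  = eval ∇ Δ v φ ⇒ₜ eval ∇ Δ v ψ
  eval ∇ Δ v (∼ φ)    = ∼ₜ eval ∇ Δ v φ

  TwModels : {ℓ : Level} → (∇ Δ : Carrier → Set ℓ) → Fm → Set (c ⊔ ℓ ⊔ ℓ₁)
  TwModels ∇ Δ φ = ∀ (v : ℕ → TwElem ∇ Δ) → proj₁ (eval ∇ Δ v φ) ≈ ⊤

  ProperModel : {ℓ : Level} → (∇ Δ : Carrier → Set ℓ) → (Fm → Set) → Set (c ⊔ ℓ ⊔ ℓ₁)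
  ProperModel ∇ Δ L = ∀ φ → TwModels ∇ Δ φ ⇔ L φ

-- A Heyting algebra A is the algebra of open elements of its Boolean extension B, an interior
-- algebra whose interior int z is the largest element of A below z.  The pairs (x , y) of B with
-- int x ∨ int y ∈ ∇ and x ∧ y below the closure of some element of Δ form a twist structure over B,
-- with □ (x , y) = (int x , ◇ y), which validates BS4: implications stay inside because
-- int x ∨ int (¬ x) is dense, and interiors of such pairs lie in Tw(A, ∇, Δ) because Δ is closed
-- (the closure of d ∈ A meets A below ¬ ¬ d).  On pairs coming from Tw(A, ∇, Δ), T_B φ evaluates
-- to the value of φ there, so T_B φ is valid in the twist structure over B exactly when φ holds in
-- Tw(A, ∇, Δ), i.e. when φ ∈ L.  Hence all of τ_B L is valid, and T_B φ ∈ τ_B L forces φ ∈ L.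

module Submission where

open import Defs
open import Level using (Level; _⊔_)
open import Relation.Binary.Lattice.Bundles using (HeytingAlgebra)
open import Data.Nat using (ℕ)
open import Data.Product using (_×_; _,_; proj₁; proj₂; Σ)
open import Data.Sum using (_⊎_; inj₁; inj₂)
open import Data.List using (List; []; _∷_; _++_)
open import Data.List.Relation.Unary.All as All using (All; []; _∷_)
open import Data.List.Relation.Unary.All.Properties using (++⁺; ++⁻ˡ; ++⁻ʳ)
open import Data.List.Membership.Propositional using (_∈_)
open import Data.List.Relation.Unary.Any using (here; there)
open import Data.List.Properties using (++-assoc; ++-identityʳ)
open import Function.Bundles using (mk⇔; Equivalence)
open import Relation.Binary.PropositionalEquality as ≡ using (_≡_)
import Relation.Binary.Lattice.Properties.HeytingAlgebra as HeytingProperties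
import Relation.Binary.Lattice.Properties.MeetSemilattice as MeetProperties
import Relation.Binary.Lattice.Properties.JoinSemilattice as JoinProperties

module HeytingLattice {c ℓ₁ ℓ₂ : Level} (A : HeytingAlgebra c ℓ₁ ℓ₂) where
  open HeytingAlgebra A
  open HeytingProperties A public using (¬_; ⇨-eval)
  open HeytingProperties A using (⇨ˡ-contravariant; de-morgan₁; ∧-distribˡ-∨-≤)
  open MeetProperties meetSemilattice public using (∧-monotonic)
  open JoinProperties joinSemilattice public using (∨-monotonic)

  module _ {a b : Carrier} where
    ∧-elimˡ : a ∧ b ≤ a
    ∧-elimˡ = x∧y≤x a b
    ∧-elimʳ : a ∧ b ≤ b
    ∧-elimʳ = x∧y≤y a b
    ∨-introˡ : a ≤ a ∨ b
    ∨-introˡ = x≤x∨y a b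
    ∨-introʳ : b ≤ a ∨ b
    ∨-introʳ = y≤x∨y a b
    ∧-comm-≤ : a ∧ b ≤ b ∧ a
    ∧-comm-≤ = ∧-greatest (x∧y≤y a b) (x∧y≤x a b)
    ∨-comm-≤ : a ∨ b ≤ b ∨ a
    ∨-comm-≤ = ∨-least (y≤x∨y b a) (x≤x∨y b a)

  ≤⊤ : ∀ {a} → a ≤ ⊤
  ≤⊤ = maximum _

  ⊥≤ : ∀ {a} → ⊥ ≤ a
  ⊥≤ = minimum _

  ∧-∨-distribˡ : ∀ {a b d} → a ∧ (b ∨ d) ≤ (a ∧ b) ∨ (a ∧ d)
  ∧-∨-distribˡ = ∧-distribˡ-∨-≤ _ _ _

  ∧-∨-distribʳ : ∀ {a b d} → (a ∨ b) ∧ d ≤ (a ∧ d) ∨ (b ∧ d)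
  ∧-∨-distribʳ = trans ∧-comm-≤ (trans ∧-∨-distribˡ (∨-monotonic ∧-comm-≤ ∧-comm-≤))

  ∨-swapʳ : ∀ {b x y} → (b ∨ x) ∨ y ≤ (b ∨ y) ∨ x
  ∨-swapʳ = ∨-least (∨-monotonic ∨-introˡ refl) (trans ∨-introʳ ∨-introˡ)

  ∧-swapʳ : ∀ {a x y} → (a ∧ x) ∧ y ≤ (a ∧ y) ∧ x
  ∧-swapʳ = ∧-greatest (∧-monotonic ∧-elimˡ refl) (trans ∧-elimˡ ∧-elimʳ)

  ∧-∨-∨-≤ : ∀ {a b c′ d} → (a ∨ b) ∧ (c′ ∨ d) ≤ (a ∧ c′) ∨ (b ∨ d)
  ∧-∨-∨-≤ = trans ∧-∨-distribʳ
    (∨-least (trans ∧-∨-distribˡ (∨-monotonic refl (trans ∧-elimʳ ∨-introʳ)))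
             (trans ∧-elimˡ (trans ∨-introˡ ∨-introʳ)))

  ∧-∨-∨-≤′ : ∀ {a b c′ d} → (a ∨ b) ∧ (c′ ∨ d) ≤ (a ∨ c′) ∨ (b ∧ d)
  ∧-∨-∨-≤′ = trans (∧-monotonic ∨-comm-≤ ∨-comm-≤) (trans ∧-∨-∨-≤ ∨-comm-≤)

  ¬-antitone : ∀ {a b} → a ≤ b → ¬ b ≤ ¬ a
  ¬-antitone = ⇨ˡ-contravariant

  ¬-intro : ∀ {x a} → x ∧ a ≤ ⊥ → x ≤ ¬ a
  ¬-intro = transpose-⇨

  ¬-elim : ∀ {t u a} → t ≤ ¬ a → u ≤ a → t ∧ u ≤ ⊥
  ¬-elim p q = trans (∧-monotonic p q) ⇨-eval

  ¬-∨ : ∀ {a b} → ¬ a ∧ ¬ b ≤ ¬ (a ∨ b)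
  ¬-∨ {a} {b} = reflexive (Eq.sym (de-morgan₁ a b))

  dense-mono : ∀ {s t} → s ≤ t → ¬ s ≤ ⊥ → ¬ t ≤ ⊥
  dense-mono p h = trans (¬-antitone p) h

  diff-∨-⇨-dense : ∀ {a b} → ¬ ((a ∧ ¬ b) ∨ (a ⇨ b)) ≤ ⊥
  diff-∨-⇨-dense {a} {b} =
    trans (∧-greatest refl ¬a) (¬-elim refl (trans (transpose-⇨ (trans ⇨-eval ⊥≤)) ∨-introʳ))
    where
      ¬b : ¬ ((a ∧ ¬ b) ∨ (a ⇨ b)) ≤ ¬ b
      ¬b = ¬-intro (¬-elim refl (trans (transpose-⇨ ∧-elimˡ) ∨-introʳ))
      ¬a : ¬ ((a ∧ ¬ b) ∨ (a ⇨ b)) ≤ ¬ a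
      ¬a = ¬-intro (trans (∧-greatest ∧-elimˡ (∧-greatest ∧-elimʳ (trans ∧-elimˡ ¬b))) (¬-elim refl ∨-introˡ))

  dense-∨-∧ : ∀ {u u′ v v′} → ¬ (u ∨ u′) ≤ ⊥ → ¬ (v ∨ v′) ≤ ⊥ → ¬ (u ∨ (v ∨ (u′ ∧ v′))) ≤ ⊥
  dense-∨-∧ {u} {u′} {v} {v′} h₁ h₂ = trans (∧-greatest ¬u ¬u′) (trans ¬-∨ h₁)
    where
      w : Carrier
      w = ¬ (u ∨ (v ∨ (u′ ∧ v′)))
      ¬u : w ≤ ¬ u
      ¬u = ¬-intro (¬-elim refl ∨-introˡ)
      ¬v : w ≤ ¬ v
      ¬v = ¬-intro (¬-elim refl (trans ∨-introˡ ∨-introʳ))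
      ¬v′ : w ∧ u′ ≤ ¬ v′
      ¬v′ = ¬-intro (trans (∧-greatest (trans ∧-elimˡ ∧-elimˡ) (∧-greatest (trans ∧-elimˡ ∧-elimʳ) ∧-elimʳ))
                           (¬-elim refl (trans ∨-introʳ ∨-introʳ)))
      ¬u′ : w ≤ ¬ u′
      ¬u′ = ¬-intro (trans (∧-greatest (trans ∧-elimˡ ¬v) ¬v′) (trans ¬-∨ h₂))

-- An element of the Boolean extension of A is a finite list of differences, a pair (a , b)
-- standing for a ∧ ¬ b and a list for the join of its entries.  Comparisons are computed
-- one difference at a time:  a ≤ b ∨ (c ∧ ¬ d) ∨ r  iff  a ≤ b ∨ c ∨ r  and  a ∧ d ≤ b ∨ r.
module BooleanExtension {c ℓ₁ ℓ₂ : Level} (A : HeytingAlgebra c ℓ₁ ℓ₂) where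
  open HeytingAlgebra A
  open HeytingLattice A

  𝔹 : Set c
  𝔹 = List (Carrier × Carrier)

  infix 4 _≤_∨⋁_ _⊑_
  _≤_∨⋁_ : Carrier → Carrier → 𝔹 → Set ℓ₂
  a ≤ b ∨⋁ [] = a ≤ b
  a ≤ b ∨⋁ ((c′ , d) ∷ z) = (a ≤ b ∨ c′ ∨⋁ z) × (a ∧ d ≤ b ∨⋁ z)

  ≤∨⋁-adjust : ∀ {a b a′ b′} z → a ≤ b ∨⋁ z → a′ ≤ a ∨ b′ → a′ ∧ b ≤ b′ → a′ ≤ b′ ∨⋁ z
  ≤∨⋁-adjust [] h p q =
    trans (∧-greatest refl (trans p (∨-monotonic h refl)))
          (trans ∧-∨-distribˡ (∨-least q ∧-elimʳ))
  ≤∨⋁-adjust ((c′ , d) ∷ z) (h₁ , h₂) p q =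
    ≤∨⋁-adjust z h₁ (trans p (∨-monotonic refl ∨-introˡ)) (trans ∧-∨-distribˡ (∨-monotonic q ∧-elimʳ)) ,
    ≤∨⋁-adjust z h₂ (trans (∧-monotonic p refl) (trans ∧-∨-distribʳ (∨-monotonic refl ∧-elimˡ)))
                    (trans (∧-monotonic ∧-elimˡ refl) q)

  ≤∨⋁-mono : ∀ {a b a′ b′} z → a ≤ b ∨⋁ z → a′ ≤ a → b ≤ b′ → a′ ≤ b′ ∨⋁ z
  ≤∨⋁-mono z h p q = ≤∨⋁-adjust z h (trans p ∨-introˡ) (trans ∧-elimʳ q)

  ≤⇒≤∨⋁ : ∀ {a b} z → a ≤ b → a ≤ b ∨⋁ z
  ≤⇒≤∨⋁ [] p = p
  ≤⇒≤∨⋁ ((c′ , d) ∷ z) p = ≤⇒≤∨⋁ z (trans p ∨-introˡ) , ≤⇒≤∨⋁ z (trans ∧-elimˡ p)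

  ≤∨⋁-cut : ∀ {a b x} z → a ≤ b ∨ x ∨⋁ z → a ∧ x ≤ b ∨⋁ z → a ≤ b ∨⋁ z
  ≤∨⋁-cut [] p q = trans (∧-greatest refl p) (trans ∧-∨-distribˡ (∨-least ∧-elimʳ q))
  ≤∨⋁-cut ((c′ , d) ∷ z) (p₁ , p₂) (q₁ , q₂) =
    ≤∨⋁-cut z (≤∨⋁-mono z p₁ refl ∨-swapʳ) q₁ ,
    ≤∨⋁-cut z p₂ (≤∨⋁-mono z q₂ ∧-swapʳ refl)

  ≤∨⋁-++⁺ˡ : ∀ {a b} w z → a ≤ b ∨⋁ z → a ≤ b ∨⋁ (w ++ z)
  ≤∨⋁-++⁺ˡ [] z h = h
  ≤∨⋁-++⁺ˡ (_ ∷ w) z h =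
    ≤∨⋁-++⁺ˡ w z (≤∨⋁-mono z h refl ∨-introˡ) , ≤∨⋁-++⁺ˡ w z (≤∨⋁-mono z h ∧-elimˡ refl)

  ≤∨⋁-++⁺ʳ : ∀ {a b} z w → a ≤ b ∨⋁ z → a ≤ b ∨⋁ (z ++ w)
  ≤∨⋁-++⁺ʳ [] w h = ≤⇒≤∨⋁ w h
  ≤∨⋁-++⁺ʳ (_ ∷ z) w (h₁ , h₂) = ≤∨⋁-++⁺ʳ z w h₁ , ≤∨⋁-++⁺ʳ z w h₂

  ≤∨⋁-++⁺-middle : ∀ {a b r} u m → a ≤ b ∨⋁ (u ++ r) → a ≤ b ∨⋁ (u ++ (m ++ r))
  ≤∨⋁-++⁺-middle {r = r} [] m h = ≤∨⋁-++⁺ˡ m r h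
  ≤∨⋁-++⁺-middle (_ ∷ u) m (h₁ , h₂) = ≤∨⋁-++⁺-middle u m h₁ , ≤∨⋁-++⁺-middle u m h₂

  Below : 𝔹 → Carrier × Carrier → Set ℓ₂
  Below y (a , b) = a ≤ b ∨⋁ y

  record _⊑_ (x y : 𝔹) : Set (c ⊔ ℓ₂) where
    constructor ⊑⟨_⟩
    field entries : All (Below y) x
  open _⊑_ public

  ≤∨⋁-trans : ∀ {a b} y z → a ≤ b ∨⋁ y → y ⊑ z → a ≤ b ∨⋁ z
  ≤∨⋁-trans [] z h _ = ≤⇒≤∨⋁ z h
  ≤∨⋁-trans ((c′ , d) ∷ y) z (h₁ , h₂) ⊑⟨ hcd ∷ hy ⟩ =
    ≤∨⋁-cut z (≤∨⋁-trans y z h₁ ⊑⟨ hy ⟩)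
      (≤∨⋁-cut z (≤∨⋁-adjust z hcd (trans ∧-elimʳ ∨-introˡ) (trans ∧-elimʳ ∨-introʳ))
                 (≤∨⋁-mono z (≤∨⋁-trans y z h₂ ⊑⟨ hy ⟩) (∧-monotonic ∧-elimˡ refl) refl))

  ⊑-trans : ∀ {x y z} → x ⊑ y → y ⊑ z → x ⊑ z
  ⊑-trans {y = y} {z} ⊑⟨ xy ⟩ yz = ⊑⟨ All.map (λ h → ≤∨⋁-trans y z h yz) xy ⟩

  ⊑-refl : ∀ {x} → x ⊑ x
  ⊑-refl {[]} = ⊑⟨ [] ⟩
  ⊑-refl {(c′ , d) ∷ x} =
    ⊑⟨ (≤⇒≤∨⋁ x ∨-introʳ , ≤⇒≤∨⋁ x ∧-elimʳ) ∷ All.map (≤∨⋁-++⁺ˡ ((c′ , d) ∷ []) x) (entries ⊑-refl) ⟩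

  ≡⇒⊑ : ∀ {x y} → x ≡ y → x ⊑ y
  ≡⇒⊑ ≡.refl = ⊑-refl

  []⊑ : ∀ {x} → [] ⊑ x
  []⊑ = ⊑⟨ [] ⟩

  ++-lub : ∀ {x y z} → x ⊑ z → y ⊑ z → x ++ y ⊑ z
  ++-lub ⊑⟨ p ⟩ ⊑⟨ q ⟩ = ⊑⟨ ++⁺ p q ⟩

  x⊑x++y : ∀ {x y} → x ⊑ x ++ y
  x⊑x++y {x} {y} = ⊑⟨ All.map (≤∨⋁-++⁺ʳ x y) (entries (⊑-refl {x})) ⟩

  y⊑x++y : ∀ {x y} → y ⊑ x ++ y
  y⊑x++y {x} {y} = ⊑⟨ All.map (≤∨⋁-++⁺ˡ x y) (entries (⊑-refl {y})) ⟩

  -- (a ∧ ¬ b) ∧ (c ∧ ¬ d) = (a ∧ c) ∧ ¬ (b ∨ d)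
  diff-⊓ : Carrier → Carrier → 𝔹 → 𝔹
  diff-⊓ a b [] = []
  diff-⊓ a b ((c′ , d) ∷ y) = (a ∧ c′ , b ∨ d) ∷ diff-⊓ a b y

  infixr 6 _⊓_
  _⊓_ : 𝔹 → 𝔹 → 𝔹
  [] ⊓ y = []
  ((a , b) ∷ x) ⊓ y = diff-⊓ a b y ++ (x ⊓ y)

  ⊓-lbˡ : ∀ x y → x ⊓ y ⊑ x
  ⊓-lbˡ [] y = []⊑
  ⊓-lbˡ ((a , b) ∷ x) y =
    ++-lub (diff-⊓-lb y) ⊑⟨ All.map (≤∨⋁-++⁺ˡ ((a , b) ∷ []) x) (entries (⊓-lbˡ x y)) ⟩
    where
      diff-⊓-lb : ∀ y → diff-⊓ a b y ⊑ (a , b) ∷ x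
      diff-⊓-lb [] = []⊑
      diff-⊓-lb (_ ∷ y) =
        ⊑⟨ (≤⇒≤∨⋁ x (trans ∧-elimˡ ∨-introʳ) , ≤⇒≤∨⋁ x (trans ∧-elimʳ ∨-introˡ)) ∷ entries (diff-⊓-lb y) ⟩

  ⊓-lbʳ : ∀ x y → x ⊓ y ⊑ y
  ⊓-lbʳ [] y = []⊑
  ⊓-lbʳ ((a , b) ∷ x) y = ++-lub (diff-⊓-lb y) (⊓-lbʳ x y)
    where
      diff-⊓-lb : ∀ y → diff-⊓ a b y ⊑ y
      diff-⊓-lb [] = []⊑
      diff-⊓-lb ((c′ , d) ∷ y) =
        ⊑⟨ (≤⇒≤∨⋁ y (trans ∧-elimʳ ∨-introʳ) , ≤⇒≤∨⋁ y (trans ∧-elimʳ ∨-introʳ))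
           ∷ All.map (≤∨⋁-++⁺ˡ ((c′ , d) ∷ []) y) (entries (diff-⊓-lb y)) ⟩

  ≤∨⋁-diff-⊓ : ∀ {a b c′ d} y r → a ≤ b ∨⋁ (y ++ r) → a ∧ c′ ≤ b ∨ d ∨⋁ (diff-⊓ c′ d y ++ r)
  ≤∨⋁-diff-⊓ [] r h = ≤∨⋁-mono r h ∧-elimˡ ∨-introˡ
  ≤∨⋁-diff-⊓ {c′ = c′} {d} (_ ∷ y) r (h₁ , h₂) =
    ≤∨⋁-adjust (diff-⊓ c′ d y ++ r) (≤∨⋁-diff-⊓ y r h₁) ∨-introˡ joined ,
    ≤∨⋁-adjust (diff-⊓ c′ d y ++ r) (≤∨⋁-diff-⊓ y r h₂) split ∧-elimʳ
    where
      joined : ∀ {a b g} → (a ∧ c′) ∧ ((b ∨ g) ∨ d) ≤ (b ∨ d) ∨ (c′ ∧ g)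
      joined = trans ∧-∨-distribˡ (∨-least
        (trans ∧-∨-distribˡ (∨-least (trans ∧-elimʳ (trans ∨-introˡ ∨-introˡ))
                                     (trans (∧-monotonic ∧-elimʳ refl) ∨-introʳ)))
        (trans ∧-elimʳ (trans ∨-introʳ ∨-introˡ)))
      split : ∀ {a b h} → (a ∧ c′) ∧ (d ∨ h) ≤ ((a ∧ h) ∧ c′) ∨ (b ∨ d)
      split = trans ∧-∨-distribˡ (∨-least (trans ∧-elimʳ (trans ∨-introʳ ∨-introʳ))
        (trans (∧-greatest (∧-greatest (trans ∧-elimˡ ∧-elimˡ) ∧-elimʳ) (trans ∧-elimˡ ∧-elimʳ)) ∨-introˡ))

  ≤∨⋁-⊓-++ : ∀ {a b} x y r → a ≤ b ∨⋁ (x ++ r) → a ≤ b ∨⋁ (y ++ r) → a ≤ b ∨⋁ ((x ⊓ y) ++ r)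
  ≤∨⋁-⊓-++ [] y r h₁ h₂ = h₁
  ≤∨⋁-⊓-++ ((c′ , d) ∷ x) y r (h₁ , h₂) hy
    rewrite ++-assoc (diff-⊓ c′ d y) (x ⊓ y) r =
    ≤∨⋁-cut rest (≤∨⋁-++⁺ˡ (diff-⊓ c′ d y) ((x ⊓ y) ++ r)
                   (≤∨⋁-⊓-++ x y r h₁ (≤∨⋁-mono (y ++ r) hy refl ∨-introˡ)))
      (≤∨⋁-cut rest (≤∨⋁-++⁺-middle (diff-⊓ c′ d y) (x ⊓ y) (≤∨⋁-diff-⊓ y r hy))
                    (≤∨⋁-++⁺ˡ (diff-⊓ c′ d y) ((x ⊓ y) ++ r)
                       (≤∨⋁-⊓-++ x y r (≤∨⋁-mono (x ++ r) h₂ (∧-monotonic ∧-elimˡ refl) refl)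
                                       (≤∨⋁-mono (y ++ r) hy (trans ∧-elimˡ ∧-elimˡ) refl))))
    where rest = diff-⊓ c′ d y ++ ((x ⊓ y) ++ r)

  ≤∨⋁-⊓ : ∀ {a b} x y → a ≤ b ∨⋁ x → a ≤ b ∨⋁ y → a ≤ b ∨⋁ (x ⊓ y)
  ≤∨⋁-⊓ {a} {b} x y h₁ h₂ = ≡.subst (a ≤ b ∨⋁_) (++-identityʳ (x ⊓ y))
    (≤∨⋁-⊓-++ x y [] (≡.subst (a ≤ b ∨⋁_) (≡.sym (++-identityʳ x)) h₁)
                     (≡.subst (a ≤ b ∨⋁_) (≡.sym (++-identityʳ y)) h₂))

  ⊓-glb : ∀ {z x y} → z ⊑ x → z ⊑ y → z ⊑ x ⊓ y
  ⊓-glb {x = x} {y} ⊑⟨ p ⟩ ⊑⟨ q ⟩ = ⊑⟨ All.zipWith (λ (h , k) → ≤∨⋁-⊓ x y h k) (p , q) ⟩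

  ⊓-mono : ∀ {x x′ y y′} → x ⊑ x′ → y ⊑ y′ → x ⊓ y ⊑ x′ ⊓ y′
  ⊓-mono {x} {x′} {y} {y′} p q = ⊓-glb (⊑-trans (⊓-lbˡ x y) p) (⊑-trans (⊓-lbʳ x y) q)

  ⊓-distribʳ-++ : ∀ u v w → (u ++ v) ⊓ w ≡ (u ⊓ w) ++ (v ⊓ w)
  ⊓-distribʳ-++ [] v w = ≡.refl
  ⊓-distribʳ-++ ((a , b) ∷ u) v w =
    ≡.trans (≡.cong (diff-⊓ a b w ++_) (⊓-distribʳ-++ u v w))
            (≡.sym (++-assoc (diff-⊓ a b w) (u ⊓ w) (v ⊓ w)))

  -- ¬ (a ∧ ¬ b) = (⊤ ∧ ¬ a) ∨ (b ∧ ¬ ⊥)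
  ∁-diff : Carrier → Carrier → 𝔹
  ∁-diff a b = (⊤ , a) ∷ (b , ⊥) ∷ []

  ∁_ : 𝔹 → 𝔹
  ∁ [] = (⊤ , ⊥) ∷ []
  ∁ ((a , b) ∷ x) = ∁-diff a b ⊓ ∁ x

  ∁-⊑-∁-diff : ∀ {a b} x → (a , b) ∈ x → ∁ x ⊑ ∁-diff a b
  ∁-⊑-∁-diff ((a , b) ∷ x) (here ≡.refl) = ⊓-lbˡ (∁-diff a b) (∁ x)
  ∁-⊑-∁-diff ((a , b) ∷ x) (there i) = ⊑-trans (⊓-lbʳ (∁-diff a b) (∁ x)) (∁-⊑-∁-diff x i)

  ≤∨⋁-∁-++ : ∀ {a b} x r → All (λ (c′ , d) → a ∧ c′ ≤ b ∨ d ∨⋁ r) x → a ≤ b ∨⋁ (∁ x ++ r)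
  ≤∨⋁-∁-++ [] r [] = ≤⇒≤∨⋁ r (trans ≤⊤ ∨-introʳ) , ≤⇒≤∨⋁ r (trans ∧-elimʳ ⊥≤)
  ≤∨⋁-∁-++ ((c′ , d) ∷ x) r (h ∷ hs) =
    ≤∨⋁-⊓-++ (∁-diff c′ d) (∁ x) r
      (≤⇒≤∨⋁ ((d , ⊥) ∷ r) (trans ≤⊤ ∨-introʳ) , (h , ≤⇒≤∨⋁ r (trans ∧-elimʳ ⊥≤)))
      (≤∨⋁-∁-++ x r hs)

  ⊓-transpose-∁ : ∀ z x y → z ⊓ x ⊑ y → z ⊑ ∁ x ++ y
  ⊓-transpose-∁ [] x y _ = []⊑
  ⊓-transpose-∁ ((a , b) ∷ z) x y ⊑⟨ h ⟩ =
    ⊑⟨ ≤∨⋁-∁-++ x y (diff-⊓-entries x (++⁻ˡ (diff-⊓ a b x) h))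
       ∷ entries (⊓-transpose-∁ z x y ⊑⟨ ++⁻ʳ (diff-⊓ a b x) h ⟩) ⟩
    where
      diff-⊓-entries : ∀ x → All (Below y) (diff-⊓ a b x) → All (λ (c′ , d) → a ∧ c′ ≤ b ∨ d ∨⋁ y) x
      diff-⊓-entries [] _ = []
      diff-⊓-entries (_ ∷ x) (h ∷ hs) = h ∷ diff-⊓-entries x hs

  ∁x⊓x⊑[] : ∀ x → ∁ x ⊓ x ⊑ []
  ∁x⊓x⊑[] x = disjoint (∁ x) (All.tabulate λ p∈ → All.tabulate λ q∈ →
                proj₁ (proj₂ (All.lookup (entries (∁-⊑-∁-diff x q∈)) p∈)))
    where
      disjoint : ∀ u → All (λ (a , b) → All (λ (c′ , d) → a ∧ c′ ≤ b ∨ d) x) u → u ⊓ x ⊑ []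
      disjoint [] [] = []⊑
      disjoint ((a , b) ∷ u) (h ∷ hs) = ++-lub (diff-⊓-disjoint x h) (disjoint u hs)
        where
          diff-⊓-disjoint : ∀ x → All (λ (c′ , d) → a ∧ c′ ≤ b ∨ d) x → diff-⊓ a b x ⊑ []
          diff-⊓-disjoint [] [] = []⊑
          diff-⊓-disjoint (_ ∷ x) (h ∷ hs) = ⊑⟨ h ∷ entries (diff-⊓-disjoint x hs) ⟩

  ⊓-transpose-++ : ∀ z x y → z ⊑ ∁ x ++ y → z ⊓ x ⊑ y
  ⊓-transpose-++ z x y h = ⊑-trans (⊓-mono h (⊑-refl {x}))
    (⊑-trans (≡⇒⊑ (⊓-distribʳ-++ (∁ x) y x)) (++-lub (⊑-trans (∁x⊓x⊑[] x) []⊑) (⊓-lbˡ y x)))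

  infix 5 _⇨[_∨⋁_]
  _⇨[_∨⋁_] : Carrier → Carrier → 𝔹 → Carrier
  a ⇨[ b ∨⋁ [] ] = a ⇨ b
  a ⇨[ b ∨⋁ (c′ , d) ∷ z ] = (a ⇨[ b ∨ c′ ∨⋁ z ]) ∧ (a ∧ d ⇨[ b ∨⋁ z ])

  transpose-∧∨⋁ : ∀ {o a b} z → o ≤ a ⇨[ b ∨⋁ z ] → o ∧ a ≤ b ∨⋁ z
  transpose-∧∨⋁ [] h = transpose-∧ h
  transpose-∧∨⋁ (_ ∷ z) h =
    transpose-∧∨⋁ z (trans h ∧-elimˡ) ,
    ≤∨⋁-mono z (transpose-∧∨⋁ z (trans h ∧-elimʳ))
      (∧-greatest (trans ∧-elimˡ ∧-elimˡ) (∧-monotonic ∧-elimʳ refl)) refl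

  transpose-⇨∨⋁ : ∀ {o a b} z → o ∧ a ≤ b ∨⋁ z → o ≤ a ⇨[ b ∨⋁ z ]
  transpose-⇨∨⋁ [] h = transpose-⇨ h
  transpose-⇨∨⋁ (_ ∷ z) (h₁ , h₂) =
    ∧-greatest (transpose-⇨∨⋁ z h₁)
      (transpose-⇨∨⋁ z (≤∨⋁-mono z h₂ (∧-greatest (∧-monotonic refl ∧-elimˡ) (trans ∧-elimʳ ∧-elimʳ)) refl))

  ι : Carrier → 𝔹
  ι a = (a , ⊥) ∷ []

  int : 𝔹 → Carrier
  int z = ⊤ ⇨[ ⊥ ∨⋁ z ]

  ι⊑⇒≤int : ∀ {o} z → ι o ⊑ z → o ≤ int z
  ι⊑⇒≤int z ⊑⟨ h ∷ [] ⟩ = transpose-⇨∨⋁ z (≤∨⋁-mono z h ∧-elimˡ refl)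

  ≤int⇒ι⊑ : ∀ {o} z → o ≤ int z → ι o ⊑ z
  ≤int⇒ι⊑ z h = ⊑⟨ ≤∨⋁-mono z (transpose-∧∨⋁ z h) (∧-greatest refl ≤⊤) refl ∷ [] ⟩

  ι-int⊑ : ∀ z → ι (int z) ⊑ z
  ι-int⊑ z = ≤int⇒ι⊑ z refl

  int-mono : ∀ {x y} → x ⊑ y → int x ≤ int y
  int-mono {x} {y} h = ι⊑⇒≤int y (⊑-trans (ι-int⊑ x) h)

  ι-mono : ∀ {a b} → a ≤ b → ι a ⊑ ι b
  ι-mono h = ⊑⟨ (trans h ∨-introʳ , ∧-elimʳ) ∷ [] ⟩

  ι-reflects : ∀ {a b} → ι a ⊑ ι b → a ≤ b
  ι-reflects ⊑⟨ (h , _) ∷ [] ⟩ = trans h (∨-least ⊥≤ refl)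

  ι-⊓ : ∀ {a b} → ι a ⊓ ι b ⊑ ι (a ∧ b)
  ι-⊓ = ⊑⟨ (∨-introʳ , trans ∧-elimʳ ∨-introˡ) ∷ [] ⟩

  ⊑ι⊤ : ∀ {x} → x ⊑ ι ⊤
  ⊑ι⊤ {[]} = []⊑
  ⊑ι⊤ {_ ∷ x} = ⊑⟨ (trans ≤⊤ ∨-introʳ , trans ∧-elimʳ ⊥≤) ∷ entries (⊑ι⊤ {x}) ⟩

  int-⊓ : ∀ {x y} → int x ∧ int y ≤ int (x ⊓ y)
  int-⊓ {x} {y} = ι⊑⇒≤int (x ⊓ y)
    (⊓-glb (⊑-trans (ι-mono ∧-elimˡ) (ι-int⊑ x)) (⊑-trans (ι-mono ∧-elimʳ) (ι-int⊑ y)))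

  int∨int∁-dense : ∀ x → ¬ (int x ∨ int (∁ x)) ≤ ⊥
  int∨int∁-dense [] =
    dense-mono (trans ≤⊤ (trans (ι⊑⇒≤int (∁ []) ⊑-refl) ∨-introʳ)) (trans (∧-greatest refl ≤⊤) ⇨-eval)
  int∨int∁-dense ((a , b) ∷ x) =
    dense-mono (∨-least (trans (int-mono (x⊑x++y {(a , b) ∷ []} {x})) ∨-introˡ)
                        (∨-least (trans (int-mono (y⊑x++y {(a , b) ∷ []} {x})) ∨-introˡ)
                                 (trans (int-⊓ {∁-diff a b} {∁ x}) ∨-introʳ)))
      (dense-∨-∧ (dense-mono (∨-monotonic diff≤int ⇨≤int) diff-∨-⇨-dense) (int∨int∁-dense x))
    where
      diff≤int : a ∧ ¬ b ≤ int ((a , b) ∷ [])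
      diff≤int = ι⊑⇒≤int ((a , b) ∷ [])
        ⊑⟨ (trans ∧-elimˡ ∨-introʳ , trans (∧-monotonic ∧-elimʳ refl) ⇨-eval) ∷ [] ⟩
      ⇨≤int : a ⇨ b ≤ int (∁-diff a b)
      ⇨≤int = ι⊑⇒≤int (∁-diff a b)
        ⊑⟨ (≤⇒≤∨⋁ ((b , ⊥) ∷ []) (trans ≤⊤ ∨-introʳ) , (trans (transpose-∧ refl) ∨-introʳ , ∧-elimʳ)) ∷ [] ⟩

-- Terms over the Boolean extension, compared through their normal forms.  Their constructors
-- are injective, which makes the arguments of the order lemmas below inferable.
module InteriorTerms {c ℓ₁ ℓ₂ : Level} (A : HeytingAlgebra c ℓ₁ ℓ₂) where
  open HeytingAlgebra A
  open HeytingLattice A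
  open BooleanExtension A

  infixr 6 _⊗_
  infixr 5 _⊕_
  infixr 8 −_ ■_ ◆_
  infix 4 _≼_
  infixr 9 _∙_

  data Term : Set c where
    ⊥ᵗ  : Term
    ⌜_⌝ : Carrier → Term
    _⊕_ : Term → Term → Term
    _⊗_ : Term → Term → Term
    −_  : Term → Term
    ■_  : Term → Term

  norm : Term → 𝔹
  norm ⊥ᵗ = []
  norm ⌜ a ⌝ = ι a
  norm (x ⊕ y) = norm x ++ norm y
  norm (x ⊗ y) = norm x ⊓ norm y
  norm (− x) = ∁ norm x
  norm (■ x) = ι (int (norm x))

  record _≼_ (x y : Term) : Set (c ⊔ ℓ₂) where
    constructor ≼⟨_⟩
    field norm-⊑ : norm x ⊑ norm y

  ⊤ᵗ : Term
  ⊤ᵗ = ⌜ ⊤ ⌝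

  ◆_ : Term → Term
  ◆ x = − ■ − x

  intᵗ : Term → Carrier
  intᵗ x = int (norm x)

  ≼-refl : ∀ {x} → x ≼ x
  ≼-refl = ≼⟨ ⊑-refl ⟩

  _∙_ : ∀ {x y z} → x ≼ y → y ≼ z → x ≼ z
  ≼⟨ p ⟩ ∙ ≼⟨ q ⟩ = ≼⟨ ⊑-trans p q ⟩

  ⊥ᵗ-least : ∀ {x} → ⊥ᵗ ≼ x
  ⊥ᵗ-least = ≼⟨ []⊑ ⟩

  ≼⊤ᵗ : ∀ {x} → x ≼ ⊤ᵗ
  ≼⊤ᵗ = ≼⟨ ⊑ι⊤ ⟩

  ⊕-lub : ∀ {x y z} → x ≼ z → y ≼ z → x ⊕ y ≼ z
  ⊕-lub ≼⟨ p ⟩ ≼⟨ q ⟩ = ≼⟨ ++-lub p q ⟩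

  ⊕-inl : ∀ {x y} → x ≼ x ⊕ y
  ⊕-inl = ≼⟨ x⊑x++y ⟩

  ⊕-inr : ∀ {x y} → y ≼ x ⊕ y
  ⊕-inr = ≼⟨ y⊑x++y ⟩

  ⊗-lbˡ : ∀ {x y} → x ⊗ y ≼ x
  ⊗-lbˡ {x} {y} = ≼⟨ ⊓-lbˡ (norm x) (norm y) ⟩

  ⊗-lbʳ : ∀ {x y} → x ⊗ y ≼ y
  ⊗-lbʳ {x} {y} = ≼⟨ ⊓-lbʳ (norm x) (norm y) ⟩

  ⊗-glb : ∀ {z x y} → z ≼ x → z ≼ y → z ≼ x ⊗ y
  ⊗-glb ≼⟨ p ⟩ ≼⟨ q ⟩ = ≼⟨ ⊓-glb p q ⟩

  ⊗-mono : ∀ {x x′ y y′} → x ≼ x′ → y ≼ y′ → x ⊗ y ≼ x′ ⊗ y′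
  ⊗-mono p q = ⊗-glb (⊗-lbˡ ∙ p) (⊗-lbʳ ∙ q)

  ⊕-mono : ∀ {x x′ y y′} → x ≼ x′ → y ≼ y′ → x ⊕ y ≼ x′ ⊕ y′
  ⊕-mono p q = ⊕-lub (p ∙ ⊕-inl) (q ∙ ⊕-inr)

  ⊗-comm : ∀ {x y} → x ⊗ y ≼ y ⊗ x
  ⊗-comm = ⊗-glb ⊗-lbʳ ⊗-lbˡ

  ⊗-distribʳ-⊕ : ∀ {u v w} → (u ⊕ v) ⊗ w ≼ (u ⊗ w) ⊕ (v ⊗ w)
  ⊗-distribʳ-⊕ {u} {v} {w} = ≼⟨ ≡⇒⊑ (⊓-distribʳ-++ (norm u) (norm v) (norm w)) ⟩

  ⊗-distribˡ-⊕ : ∀ {z u v} → z ⊗ (u ⊕ v) ≼ (z ⊗ u) ⊕ (z ⊗ v)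
  ⊗-distribˡ-⊕ = ⊗-comm ∙ ⊗-distribʳ-⊕ ∙ ⊕-mono ⊗-comm ⊗-comm

  transpose-⊕ : ∀ {z x y} → z ⊗ x ≼ y → z ≼ − x ⊕ y
  transpose-⊕ {z} {x} {y} ≼⟨ p ⟩ = ≼⟨ ⊓-transpose-∁ (norm z) (norm x) (norm y) p ⟩

  transpose-⊗ : ∀ {z x y} → z ≼ − x ⊕ y → z ⊗ x ≼ y
  transpose-⊗ {z} {x} {y} ≼⟨ p ⟩ = ≼⟨ ⊓-transpose-++ (norm z) (norm x) (norm y) p ⟩

  −x⊗x≼⊥ᵗ : ∀ {x} → − x ⊗ x ≼ ⊥ᵗ
  −x⊗x≼⊥ᵗ {x} = ≼⟨ ∁x⊓x⊑[] (norm x) ⟩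

  modus-ponens : ∀ {z a b} → z ≼ − a ⊕ b → z ≼ a → z ≼ b
  modus-ponens p q = ⊗-glb p q ∙ transpose-⊗ ≼-refl

  ⊕-intro : ∀ {x y} → x ≼ y → ⊤ᵗ ≼ − x ⊕ y
  ⊕-intro p = transpose-⊕ (⊗-lbʳ ∙ p)

  ⊕-elim : ∀ {x y} → ⊤ᵗ ≼ − x ⊕ y → x ≼ y
  ⊕-elim p = ⊗-glb ≼⊤ᵗ ≼-refl ∙ transpose-⊗ p

  ⊕-identityʳ : ∀ {x} → x ⊕ ⊥ᵗ ≼ x
  ⊕-identityʳ = ⊕-lub ≼-refl ⊥ᵗ-least

  −-intro : ∀ {z x} → z ⊗ x ≼ ⊥ᵗ → z ≼ − x
  −-intro p = transpose-⊕ p ∙ ⊕-identityʳ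

  −-antitone : ∀ {x y} → x ≼ y → − y ≼ − x
  −-antitone p = −-intro (⊗-mono ≼-refl p ∙ −x⊗x≼⊥ᵗ)

  x≼−−x : ∀ {x} → x ≼ − − x
  x≼−−x = −-intro (⊗-comm ∙ −x⊗x≼⊥ᵗ)

  −−x≼x : ∀ {x} → − − x ≼ x
  −−x≼x = ⊗-glb ≼-refl (≼⊤ᵗ ∙ ⊕-intro ≼-refl) ∙ ⊗-distribˡ-⊕ ∙ ⊕-lub (−x⊗x≼⊥ᵗ ∙ ⊥ᵗ-least) ⊗-lbʳ

  ⌜⌝-mono : ∀ {a b} → a ≤ b → ⌜ a ⌝ ≼ ⌜ b ⌝
  ⌜⌝-mono p = ≼⟨ ι-mono p ⟩

  ⌜⌝-reflects : ∀ {a b} → ⌜ a ⌝ ≼ ⌜ b ⌝ → a ≤ b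
  ⌜⌝-reflects ≼⟨ p ⟩ = ι-reflects p

  ⌜⌝⊗⌜⌝≼⌜∧⌝ : ∀ {a b} → ⌜ a ⌝ ⊗ ⌜ b ⌝ ≼ ⌜ a ∧ b ⌝
  ⌜⌝⊗⌜⌝≼⌜∧⌝ = ≼⟨ ι-⊓ ⟩

  ⌜∧⌝≼⌜⌝⊗⌜⌝ : ∀ {a b} → ⌜ a ∧ b ⌝ ≼ ⌜ a ⌝ ⊗ ⌜ b ⌝
  ⌜∧⌝≼⌜⌝⊗⌜⌝ = ⊗-glb (⌜⌝-mono ∧-elimˡ) (⌜⌝-mono ∧-elimʳ)

  intᵗ-mono : ∀ {x y} → x ≼ y → intᵗ x ≤ intᵗ y
  intᵗ-mono ≼⟨ p ⟩ = int-mono p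

  ⌜⌝≼⇒≤intᵗ : ∀ {o x} → ⌜ o ⌝ ≼ x → o ≤ intᵗ x
  ⌜⌝≼⇒≤intᵗ {x = x} ≼⟨ p ⟩ = ι⊑⇒≤int (norm x) p

  ■≼⌜intᵗ⌝ : ∀ {x} → ■ x ≼ ⌜ intᵗ x ⌝
  ■≼⌜intᵗ⌝ = ≼⟨ ⊑-refl ⟩

  ⌜intᵗ⌝≼■ : ∀ {x} → ⌜ intᵗ x ⌝ ≼ ■ x
  ⌜intᵗ⌝≼■ = ≼⟨ ⊑-refl ⟩

  ■x≼x : ∀ {x} → ■ x ≼ x
  ■x≼x {x} = ≼⟨ ι-int⊑ (norm x) ⟩

  ■-mono : ∀ {x y} → x ≼ y → ■ x ≼ ■ y
  ■-mono p = ≼⟨ ι-mono (intᵗ-mono p) ⟩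

  ≤intᵗ⌜⌝ : ∀ {a} → a ≤ intᵗ ⌜ a ⌝
  ≤intᵗ⌜⌝ = ⌜⌝≼⇒≤intᵗ ≼-refl

  intᵗ-⊗ : ∀ {x y} → intᵗ x ∧ intᵗ y ≤ intᵗ (x ⊗ y)
  intᵗ-⊗ {x} {y} = int-⊓ {norm x} {norm y}

  ■-⊗ : ∀ {x y} → ■ x ⊗ ■ y ≼ ■ (x ⊗ y)
  ■-⊗ {x} {y} = ≼⟨ ι-⊓ ⟩ ∙ ⌜⌝-mono (intᵗ-⊗ {x} {y}) ∙ ⌜intᵗ⌝≼■

  ■x≼■■x : ∀ {x} → ■ x ≼ ■ ■ x
  ■x≼■■x {x} = ■≼⌜intᵗ⌝ ∙ ⌜⌝-mono (≤intᵗ⌜⌝ {intᵗ x}) ∙ ⌜intᵗ⌝≼■ {■ x}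

  ◆-mono : ∀ {x y} → x ≼ y → ◆ x ≼ ◆ y
  ◆-mono p = −-antitone (■-mono (−-antitone p))

  x≼◆x : ∀ {x} → x ≼ ◆ x
  x≼◆x {x} = −-intro (⊗-mono ≼-refl (■x≼x {− x}) ∙ ⊗-comm ∙ −x⊗x≼⊥ᵗ)

  ◆◆x≼◆x : ∀ {x} → ◆ ◆ x ≼ ◆ x
  ◆◆x≼◆x = −-antitone (■x≼■■x ∙ ■-mono x≼−−x)

  ■⊗◆≼◆⊗ : ∀ {x y} → ■ x ⊗ ◆ y ≼ ◆ (x ⊗ y)
  ■⊗◆≼◆⊗ = −-intro (⊗-glb (⊗-lbˡ ∙ ⊗-lbʳ) (⊗-mono ⊗-lbˡ ≼-refl ∙ ■-⊗ ∙ ■-mono x⊗−[x⊗y]≼−y) ∙ −x⊗x≼⊥ᵗ)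
    where
      x⊗−[x⊗y]≼−y : ∀ {x y} → x ⊗ − (x ⊗ y) ≼ − y
      x⊗−[x⊗y]≼−y = −-intro (⊗-glb (⊗-lbˡ ∙ ⊗-lbʳ) (⊗-glb (⊗-lbˡ ∙ ⊗-lbˡ) ⊗-lbʳ) ∙ −x⊗x≼⊥ᵗ)

  ⌜⊥⌝≼⊥ᵗ : ⌜ ⊥ ⌝ ≼ ⊥ᵗ
  ⌜⊥⌝≼⊥ᵗ = ≼⟨ ⊑⟨ refl ∷ [] ⟩ ⟩

  ⌜∨⌝≼⌜⌝⊕⌜⌝ : ∀ {a b} → ⌜ a ∨ b ⌝ ≼ ⌜ a ⌝ ⊕ ⌜ b ⌝
  ⌜∨⌝≼⌜⌝⊕⌜⌝ {a} {b} =
    ≼⟨ ⊑⟨ ((∨-monotonic ∨-introʳ refl , trans ∧-elimʳ ∨-introˡ) , ≤⇒≤∨⋁ ((b , ⊥) ∷ []) ∧-elimʳ) ∷ [] ⟩ ⟩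

  ■-intro : ∀ {x} → ⊤ᵗ ≼ x → ⊤ᵗ ≼ ■ x
  ■-intro p = ⌜⌝-mono (⌜⌝≼⇒≤intᵗ p) ∙ ⌜intᵗ⌝≼■

  int◆⌜⌝≤¬¬ : ∀ a → intᵗ (◆ ⌜ a ⌝) ≤ ¬ ¬ a
  int◆⌜⌝≤¬¬ a = ¬-intro (⌜⌝-reflects
      (⌜∧⌝≼⌜⌝⊗⌜⌝ ∙ ⊗-mono (⌜intᵗ⌝≼■ ∙ ■x≼x) ⌜¬a⌝≼■−⌜a⌝ ∙ −x⊗x≼⊥ᵗ ∙ ⊥ᵗ-least {⌜ ⊥ ⌝}))
    where
      ⌜¬a⌝≼■−⌜a⌝ : ⌜ ¬ a ⌝ ≼ ■ − ⌜ a ⌝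
      ⌜¬a⌝≼■−⌜a⌝ = ⌜⌝-mono (⌜⌝≼⇒≤intᵗ (−-intro (⌜⌝⊗⌜⌝≼⌜∧⌝ ∙ ⌜⌝-mono ⇨-eval ∙ ⌜⊥⌝≼⊥ᵗ))) ∙ ⌜intᵗ⌝≼■

  infix 4 _≋_
  _≋_ : Term → Term → Set (c ⊔ ℓ₂)
  x ≋ y = (x ≼ y) × (y ≼ x)

  ≋-sym : ∀ {x y} → x ≋ y → y ≋ x
  ≋-sym (p , q) = q , p

  ⌜⌝≋■⌜⌝ : ∀ {a} → ⌜ a ⌝ ≋ ■ ⌜ a ⌝
  ⌜⌝≋■⌜⌝ = ⌜⌝-mono ≤intᵗ⌜⌝ ∙ ⌜intᵗ⌝≼■ , ■x≼x

  ⊗-≋⌜∧⌝ : ∀ {x y a b} → x ≋ ⌜ a ⌝ → y ≋ ⌜ b ⌝ → x ⊗ y ≋ ⌜ a ∧ b ⌝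
  ⊗-≋⌜∧⌝ (p , p′) (q , q′) = ⊗-mono p q ∙ ⌜⌝⊗⌜⌝≼⌜∧⌝ , ⌜∧⌝≼⌜⌝⊗⌜⌝ ∙ ⊗-mono p′ q′

  ⊕-≋⌜∨⌝ : ∀ {x y a b} → x ≋ ⌜ a ⌝ → y ≋ ⌜ b ⌝ → x ⊕ y ≋ ⌜ a ∨ b ⌝
  ⊕-≋⌜∨⌝ (p , p′) (q , q′) =
    ⊕-mono p q ∙ ⊕-lub (⌜⌝-mono ∨-introˡ) (⌜⌝-mono ∨-introʳ) , ⌜∨⌝≼⌜⌝⊕⌜⌝ ∙ ⊕-mono p′ q′

  ■⊃-≋⌜⇨⌝ : ∀ {x y a b} → x ≋ ⌜ a ⌝ → y ≋ ⌜ b ⌝ → ■ (− x ⊕ y) ≋ ⌜ a ⇨ b ⌝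
  ■⊃-≋⌜⇨⌝ {x} {y} (p , p′) (q , q′) =
    ■≼⌜intᵗ⌝ ∙ ⌜⌝-mono (transpose-⇨ (⌜⌝-reflects
      (⌜∧⌝≼⌜⌝⊗⌜⌝ ∙ ⊗-mono (⌜intᵗ⌝≼■ ∙ ■x≼x) p′ ∙ transpose-⊗ ≼-refl ∙ q))) ,
    ⌜⌝-mono (⌜⌝≼⇒≤intᵗ (transpose-⊕ (⊗-mono ≼-refl p ∙ ⌜⌝⊗⌜⌝≼⌜∧⌝ ∙ ⌜⌝-mono (transpose-∧ refl) ∙ q′)))
      ∙ ⌜intᵗ⌝≼■ {− x ⊕ y}

  intᵗ-⊕ : ∀ {x y} → intᵗ x ∨ intᵗ y ≤ intᵗ (x ⊕ y)
  intᵗ-⊕ {x} {y} = ∨-least (intᵗ-mono (⊕-inl {x} {y})) (intᵗ-mono (⊕-inr {x} {y}))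

  intᵗ-■ : ∀ {x} → intᵗ x ≤ intᵗ (■ x)
  intᵗ-■ {x} = ⌜⌝≼⇒≤intᵗ (⌜intᵗ⌝≼■ {x})

  ◆⌜⌝⊕◆⌜⌝≼◆⌜∨⌝ : ∀ {a b} → ◆ ⌜ a ⌝ ⊕ ◆ ⌜ b ⌝ ≼ ◆ ⌜ a ∨ b ⌝
  ◆⌜⌝⊕◆⌜⌝≼◆⌜∨⌝ = ⊕-lub (◆-mono (⌜⌝-mono ∨-introˡ)) (◆-mono (⌜⌝-mono ∨-introʳ))

module BooleanTwist {c ℓ₁ ℓ₂ ℓ : Level} (A : HeytingAlgebra c ℓ₁ ℓ₂) (∇ Δ : HeytingAlgebra.Carrier A → Set ℓ)
    (∇-filter : IsFilter A ∇) (∇-dense : ContainsDense A ∇)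
    (Δ-ideal : IsIdeal A Δ) (Δ-closed : ClosedIdeal A Δ) where
  open HeytingAlgebra A
  open HeytingLattice A
  open BooleanExtension A using (int∨int∁-dense)
  open InteriorTerms A
  module ∇ = IsFilter ∇-filter
  module Δ = IsIdeal Δ-ideal

  Val : Set c
  Val = Term × Term

  infixr 6 _∧ᵛ_
  infixr 5 _∨ᵛ_
  infixr 4 _⇒ᵛ_

  ⊥ᵛ : Val
  ⊥ᵛ = ⊥ᵗ , ⊤ᵗ

  _∧ᵛ_ _∨ᵛ_ _⇒ᵛ_ : Val → Val → Val
  (x , y) ∧ᵛ (x′ , y′) = x ⊗ x′ , y ⊕ y′
  (x , y) ∨ᵛ (x′ , y′) = x ⊕ x′ , y ⊗ y′
  (x , y) ⇒ᵛ (x′ , y′) = − x ⊕ x′ , x ⊗ y′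

  ∼ᵛ_ □ᵛ_ ◇ᵛ_ : Val → Val
  ∼ᵛ (x , y) = y , x
  □ᵛ (x , y) = ■ x , ◆ y
  ◇ᵛ (x , y) = ◆ x , ■ y

  ⟦_⟧ : MFm → (ℕ → Val) → Val
  ⟦ var n ⟧ w = w n
  ⟦ ⊥ₘ ⟧ w = ⊥ᵛ
  ⟦ φ ∧ₘ ψ ⟧ w = ⟦ φ ⟧ w ∧ᵛ ⟦ ψ ⟧ w
  ⟦ φ ∨ₘ ψ ⟧ w = ⟦ φ ⟧ w ∨ᵛ ⟦ ψ ⟧ w
  ⟦ φ ⇒ₘ ψ ⟧ w = ⟦ φ ⟧ w ⇒ᵛ ⟦ ψ ⟧ w
  ⟦ ∼ₘ φ ⟧ w = ∼ᵛ ⟦ φ ⟧ w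
  ⟦ □ φ ⟧ w = □ᵛ ⟦ φ ⟧ w
  ⟦ ◇ φ ⟧ w = ◇ᵛ ⟦ φ ⟧ w

  ⟦substₘ⟧ : ∀ σ φ w → ⟦ substₘ σ φ ⟧ w ≡ ⟦ φ ⟧ (λ n → ⟦ σ n ⟧ w)
  ⟦substₘ⟧ σ (var n) w = ≡.refl
  ⟦substₘ⟧ σ ⊥ₘ w = ≡.refl
  ⟦substₘ⟧ σ (φ ∧ₘ ψ) w = ≡.cong₂ _∧ᵛ_ (⟦substₘ⟧ σ φ w) (⟦substₘ⟧ σ ψ w)
  ⟦substₘ⟧ σ (φ ∨ₘ ψ) w = ≡.cong₂ _∨ᵛ_ (⟦substₘ⟧ σ φ w) (⟦substₘ⟧ σ ψ w)
  ⟦substₘ⟧ σ (φ ⇒ₘ ψ) w = ≡.cong₂ _⇒ᵛ_ (⟦substₘ⟧ σ φ w) (⟦substₘ⟧ σ ψ w)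
  ⟦substₘ⟧ σ (∼ₘ φ) w = ≡.cong ∼ᵛ_ (⟦substₘ⟧ σ φ w)
  ⟦substₘ⟧ σ (□ φ) w = ≡.cong □ᵛ_ (⟦substₘ⟧ σ φ w)
  ⟦substₘ⟧ σ (◇ φ) w = ≡.cong ◇ᵛ_ (⟦substₘ⟧ σ φ w)

  -- The counterpart of the conditions a ∨ b ∈ ∇ and a ∧ b ∈ Δ of Tw(A, ∇, Δ); the bound in Δ
  -- is only required up to the closure ◆, and Δ-closed brings it back (int◆⌜⌝≤¬¬).
  record Admissible (p : Val) : Set (c ⊔ ℓ ⊔ ℓ₂) where
    constructor admissible
    field
      filtered : ∇ (intᵗ (proj₁ p) ∨ intᵗ (proj₂ p))
      bound    : Carrier
      bound∈Δ  : Δ bound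
      bounded  : proj₁ p ⊗ proj₂ p ≼ ◆ ⌜ bound ⌝

  admissible-⊥ : Admissible ⊥ᵛ
  admissible-⊥ =
    admissible (∇.upward (trans ≤⊤ (trans (≤intᵗ⌜⌝ {⊤}) ∨-introʳ)) ∇.top) ⊥ Δ.bot (⊗-lbˡ ∙ ⊥ᵗ-least)

  admissible-∧ : ∀ {p q} → Admissible p → Admissible q → Admissible (p ∧ᵛ q)
  admissible-∧ {x , y} {x′ , y′} (admissible f d d∈Δ k) (admissible f′ d′ d′∈Δ k′) =
    admissible (∇.upward (trans ∧-∨-∨-≤ (∨-monotonic (intᵗ-⊗ {x} {x′}) (intᵗ-⊕ {y} {y′}))) (∇.meet f f′))
      (d ∨ d′) (Δ.join d∈Δ d′∈Δ)
      (⊗-distribˡ-⊕ ∙ ⊕-mono (⊗-mono ⊗-lbˡ ≼-refl ∙ k) (⊗-mono ⊗-lbʳ ≼-refl ∙ k′) ∙ ◆⌜⌝⊕◆⌜⌝≼◆⌜∨⌝)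

  admissible-∨ : ∀ {p q} → Admissible p → Admissible q → Admissible (p ∨ᵛ q)
  admissible-∨ {x , y} {x′ , y′} (admissible f d d∈Δ k) (admissible f′ d′ d′∈Δ k′) =
    admissible (∇.upward (trans ∧-∨-∨-≤′ (∨-monotonic (intᵗ-⊕ {x} {x′}) (intᵗ-⊗ {y} {y′}))) (∇.meet f f′))
      (d ∨ d′) (Δ.join d∈Δ d′∈Δ)
      (⊗-distribʳ-⊕ ∙ ⊕-mono (⊗-mono ≼-refl ⊗-lbˡ ∙ k) (⊗-mono ≼-refl ⊗-lbʳ ∙ k′) ∙ ◆⌜⌝⊕◆⌜⌝≼◆⌜∨⌝)

  -- The filter condition for an implication is where ∇ must contain the dense elements.
  admissible-⇒ : ∀ {p q} → Admissible p → Admissible q → Admissible (p ⇒ᵛ q)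
  admissible-⇒ {x , y} {x′ , y′} _ (admissible f′ d′ d′∈Δ k′) =
    admissible (∇.upward split (∇.meet (∇-dense _ (antisym (int∨int∁-dense (norm x)) ⊥≤)) f′))
      d′ d′∈Δ (⊗-glb (modus-ponens ⊗-lbˡ (⊗-lbʳ ∙ ⊗-lbˡ)) (⊗-lbʳ ∙ ⊗-lbʳ) ∙ k′)
    where
      split : (intᵗ x ∨ intᵗ (− x)) ∧ (intᵗ x′ ∨ intᵗ y′) ≤ intᵗ (− x ⊕ x′) ∨ intᵗ (x ⊗ y′)
      split = trans ∧-∨-distribʳ (∨-least
        (trans ∧-∨-distribˡ (∨-least (trans ∧-elimʳ (trans (intᵗ-mono (⊕-inr {− x} {x′})) ∨-introˡ))
                                     (trans (intᵗ-⊗ {x} {y′}) ∨-introʳ)))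
        (trans ∧-elimˡ (trans (intᵗ-mono (⊕-inl {− x} {x′})) ∨-introˡ)))

  admissible-∼ : ∀ {p} → Admissible p → Admissible (∼ᵛ p)
  admissible-∼ (admissible f d d∈Δ k) = admissible (∇.upward ∨-comm-≤ f) d d∈Δ (⊗-comm ∙ k)

  admissible-□ : ∀ {p} → Admissible p → Admissible (□ᵛ p)
  admissible-□ {x , y} (admissible f d d∈Δ k) =
    admissible (∇.upward (∨-monotonic (intᵗ-■ {x}) (intᵗ-mono (x≼◆x {y}))) f) d d∈Δ
      (■⊗◆≼◆⊗ ∙ ◆-mono k ∙ ◆◆x≼◆x)

  admissible-◇ : ∀ {p} → Admissible p → Admissible (◇ᵛ p)
  admissible-◇ {x , y} (admissible f d d∈Δ k) =
    admissible (∇.upward (∨-monotonic (intᵗ-mono (x≼◆x {x})) (intᵗ-■ {y})) f) d d∈Δ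
      (⊗-comm ∙ ■⊗◆≼◆⊗ ∙ ◆-mono (⊗-comm ∙ k) ∙ ◆◆x≼◆x)

  admissible-⟦⟧ : ∀ φ {w} → (∀ n → Admissible (w n)) → Admissible (⟦ φ ⟧ w)
  admissible-⟦⟧ (var n) aw = aw n
  admissible-⟦⟧ ⊥ₘ aw = admissible-⊥
  admissible-⟦⟧ (φ ∧ₘ ψ) aw = admissible-∧ (admissible-⟦⟧ φ aw) (admissible-⟦⟧ ψ aw)
  admissible-⟦⟧ (φ ∨ₘ ψ) aw = admissible-∨ (admissible-⟦⟧ φ aw) (admissible-⟦⟧ ψ aw)
  admissible-⟦⟧ (φ ⇒ₘ ψ) aw = admissible-⇒ (admissible-⟦⟧ φ aw) (admissible-⟦⟧ ψ aw)
  admissible-⟦⟧ (∼ₘ φ) aw = admissible-∼ (admissible-⟦⟧ φ aw)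
  admissible-⟦⟧ (□ φ) aw = admissible-□ (admissible-⟦⟧ φ aw)
  admissible-⟦⟧ (◇ φ) aw = admissible-◇ (admissible-⟦⟧ φ aw)

  Valid : MFm → Set (c ⊔ ℓ ⊔ ℓ₂)
  Valid φ = ∀ w → (∀ n → Admissible (w n)) → ⊤ᵗ ≼ proj₁ (⟦ φ ⟧ w)

  ↔-refl : ∀ {x} → ⊤ᵗ ≼ (− x ⊕ x) ⊗ (− x ⊕ x)
  ↔-refl = ⊗-glb (⊕-intro ≼-refl) (⊕-intro ≼-refl)

  valid-BS4Ax : ∀ φ → BS4Ax φ → Valid φ
  valid-BS4Ax _ a1 w _ = ⊕-intro (transpose-⊕ ⊗-lbˡ)
  valid-BS4Ax _ a2 w _ = ⊕-intro (transpose-⊕ (transpose-⊕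
    (modus-ponens (modus-ponens (⊗-lbˡ ∙ ⊗-lbˡ) ⊗-lbʳ) (modus-ponens (⊗-lbˡ ∙ ⊗-lbʳ) ⊗-lbʳ))))
  valid-BS4Ax _ a3 w _ = ⊕-intro ⊗-lbˡ
  valid-BS4Ax _ a4 w _ = ⊕-intro ⊗-lbʳ
  valid-BS4Ax _ a5 w _ = ⊕-intro (transpose-⊕ ≼-refl)
  valid-BS4Ax _ a6 w _ = ⊕-intro ⊕-inl
  valid-BS4Ax _ a7 w _ = ⊕-intro ⊕-inr
  valid-BS4Ax _ a8 w _ = ⊕-intro (transpose-⊕ (transpose-⊕ (⊗-distribˡ-⊕ ∙
    ⊕-lub (modus-ponens (⊗-lbˡ ∙ ⊗-lbˡ) ⊗-lbʳ) (modus-ponens (⊗-lbˡ ∙ ⊗-lbʳ) ⊗-lbʳ))))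
  valid-BS4Ax _ a9 w _ = ⊕-intro ⊥ᵗ-least
  valid-BS4Ax _ n1 w _ = ↔-refl
  valid-BS4Ax _ n2 w _ = ↔-refl
  valid-BS4Ax _ n3 w _ = ↔-refl
  valid-BS4Ax _ n4 w _ = ↔-refl
  valid-BS4Ax _ n5 w _ = ≼-refl
  valid-BS4Ax _ lem w _ = ⊕-intro ≼-refl ∙ ⊕-lub (⊕-inl ∙ ⊕-inr) ⊕-inl
  valid-BS4Ax _ k0 w _ = ■-intro (⊕-intro ≼-refl)
  valid-BS4Ax _ k1 w _ = ⊕-intro ■-⊗
  valid-BS4Ax _ t w _ = ⊕-intro ■x≼x
  valid-BS4Ax _ four w _ = ⊕-intro ■x≼■■x
  valid-BS4Ax _ d1 w _ = ⊗-glb (⊕-intro (⊕-identityʳ ∙ −-antitone (■-mono (−-antitone ⊕-inl ∙ −−x≼x))))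
                               (⊕-intro (−-antitone (■-mono (x≼−−x ∙ −-antitone ⊕-identityʳ)) ∙ ⊕-inl))
  valid-BS4Ax _ d2 w _ = ⊗-glb (⊕-intro (⊕-identityʳ ∙ −−x≼x ∙ ■-mono ⊕-inl))
                               (⊕-intro (■-mono ⊕-identityʳ ∙ x≼−−x ∙ ⊕-inl))
  valid-BS4Ax _ d3 w _ = ⊗-glb ↔-refl ↔-refl
  valid-BS4Ax _ d4 w _ = ⊗-glb ↔-refl ↔-refl

  valid-LeastModalLogic : ∀ {X} → (∀ φ → X φ → Valid φ) → ∀ {φ} → LeastModalLogic X φ → Valid φ
  valid-LeastModalLogic valid-X (ax {φ} x) = valid-X φ x
  valid-LeastModalLogic valid-X (sub σ {φ} d) w aw =
    ≡.subst (λ p → ⊤ᵗ ≼ proj₁ p) (≡.sym (⟦substₘ⟧ σ φ w))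
      (valid-LeastModalLogic valid-X d (λ n → ⟦ σ n ⟧ w) (λ n → admissible-⟦⟧ (σ n) aw))
  valid-LeastModalLogic valid-X (mp d e) w aw =
    modus-ponens (valid-LeastModalLogic valid-X e w aw) (valid-LeastModalLogic valid-X d w aw)
  valid-LeastModalLogic valid-X (mon□ d) w aw =
    ⊕-intro (■-mono (⊕-elim (valid-LeastModalLogic valid-X d w aw)))
  valid-LeastModalLogic valid-X (mon◇ d) w aw =
    ⊕-intro (◆-mono (⊕-elim (valid-LeastModalLogic valid-X d w aw)))

  Represents : (ℕ → TwElem A ∇ Δ) → (ℕ → Val) → Set (c ⊔ ℓ₂)
  Represents v w =
    ∀ n → (■ proj₁ (w n) ≋ ⌜ proj₁ (proj₁ (v n)) ⌝) × (■ proj₂ (w n) ≋ ⌜ proj₂ (proj₁ (v n)) ⌝)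

  TB-represents : ∀ {v w} → Represents v w → ∀ ψ →
    (proj₁ (⟦ TB ψ ⟧ w) ≋ ⌜ proj₁ (eval A ∇ Δ v ψ) ⌝) × (proj₁ (⟦ TBneg ψ ⟧ w) ≋ ⌜ proj₂ (eval A ∇ Δ v ψ) ⌝)
  TB-represents r (var n) = r n
  TB-represents r ⊥' = (⊥ᵗ-least , ⌜⊥⌝≼⊥ᵗ) , (≼-refl , ≼-refl)
  TB-represents r (ψ ∧' χ) with TB-represents r ψ | TB-represents r χ
  ... | (p , p∼) | (q , q∼) = ⊗-≋⌜∧⌝ p q , ⊕-≋⌜∨⌝ p∼ q∼
  TB-represents r (ψ ∨' χ) with TB-represents r ψ | TB-represents r χ
  ... | (p , p∼) | (q , q∼) = ⊕-≋⌜∨⌝ p q , ⊗-≋⌜∧⌝ p∼ q∼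
  TB-represents r (ψ ⇒ χ) with TB-represents r ψ | TB-represents r χ
  ... | (p , _) | (q , q∼) = ■⊃-≋⌜⇨⌝ p q , ⊗-≋⌜∧⌝ p q∼
  TB-represents r (∼ ψ) with TB-represents r ψ
  ... | (p , p∼) = p∼ , p

  interior : ∀ p → Admissible p → TwElem A ∇ Δ
  interior (x , y) (admissible f d d∈Δ k) =
    (intᵗ x , intᵗ y) , f ,
    Δ.downward (trans (intᵗ-⊗ {x} {y}) (trans (intᵗ-mono k) (int◆⌜⌝≤¬¬ d))) (Δ-closed d d∈Δ)

  embedding : TwElem A ∇ Δ → Σ Val Admissible
  embedding ((a , b) , f , a∧b∈Δ) =
    (⌜ a ⌝ , ⌜ b ⌝) , admissible (∇.upward (∨-monotonic ≤intᵗ⌜⌝ ≤intᵗ⌜⌝) f) (a ∧ b) a∧b∈Δ (⌜⌝⊗⌜⌝≼⌜∧⌝ ∙ x≼◆x)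

  TwModels⇒valid-TB : ∀ φ → TwModels A ∇ Δ φ → Valid (TB φ)
  TwModels⇒valid-TB φ models w aw =
    ⌜⌝-mono (reflexive (Eq.sym (models v))) ∙ proj₂ (proj₁ (TB-represents represents φ))
    where
      v : ℕ → TwElem A ∇ Δ
      v n = interior (w n) (aw n)
      represents : Represents v w
      represents n = (■≼⌜intᵗ⌝ , ⌜intᵗ⌝≼■) , (■≼⌜intᵗ⌝ , ⌜intᵗ⌝≼■)

  valid-TB⇒TwModels : ∀ φ → Valid (TB φ) → TwModels A ∇ Δ φ
  valid-TB⇒TwModels φ valid v =
    antisym ≤⊤ (⌜⌝-reflects (valid (λ n → proj₁ (embedding (v n))) (λ n → proj₂ (embedding (v n)))
                             ∙ proj₁ (proj₁ (TB-represents represents φ))))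
    where
      represents : Represents v (λ n → proj₁ (embedding (v n)))
      represents n = ≋-sym ⌜⌝≋■⌜⌝ , ≋-sym ⌜⌝≋■⌜⌝

  valid-τB : ∀ {L} → (∀ φ → L φ → TwModels A ∇ Δ φ) → ∀ {χ} → τB L χ → Valid χ
  valid-τB {L} sound = valid-LeastModalLogic valid-axiom
    where
      valid-axiom : ∀ χ → BS4 χ ⊎ TBImage L χ → Valid χ
      valid-axiom χ (inj₁ bs4) = valid-LeastModalLogic valid-BS4Ax bs4
      valid-axiom χ (inj₂ (φ , lφ , ≡.refl)) = TwModels⇒valid-TB φ (sound φ lφ)

+ₘ-isExtensionBS4 : ∀ X → IsExtensionBS4 (BS4 +ₘ X)
+ₘ-isExtensionBS4 X = record
  { isModalLogic = record
    { closed-subst = λ σ φ → sub σ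
    ; closed-mp    = λ φ ψ → mp
    ; closed-□     = λ φ ψ → mon□
    ; closed-◇     = λ φ ψ → mon◇
    }
  ; contains = λ φ bs4 → ax (inj₁ bs4)
  }

proposition4p1p1 : {c ℓ₁ ℓ₂ ℓ : Level} (L : Fm → Set) → IsExtensionN4 L
    → (A : HeytingAlgebra c ℓ₁ ℓ₂) (∇ Δ : HeytingAlgebra.Carrier A → Set ℓ)
    → IsFilter A ∇ → ContainsDense A ∇ → IsIdeal A Δ → ClosedIdeal A Δ
    → ProperModel A ∇ Δ L
    → ModalCompanion L (τB L)
proposition4p1p1 L _ A ∇ Δ ∇-filter ∇-dense Δ-ideal Δ-closed proper = record
  { extension = +ₘ-isExtensionBS4 (TBImage L)
  ; faithful  = λ φ → mk⇔ (λ lφ → ax (inj₂ (φ , lφ , ≡.refl)))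
                          (λ d → Equivalence.to (proper φ) (valid-TB⇒TwModels φ (valid-τB sound d)))
  }
  where
    open BooleanTwist A ∇ Δ ∇-filter ∇-dense Δ-ideal Δ-closed
    sound : ∀ φ → L φ → TwModels A ∇ Δ φ
    sound φ = Equivalence.from (proper φ)
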